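{- For every integer $\ell\ge 3$, every graph containing no induced subgraph isomorphic to the path $P_\ell$ on $\ell$ vertices has cop number at most $\ell-2$.
   Context: All graphs are finite, simple and undirected. $P_\ell$ denotes the path on $\ell$ vertices. The game of Cops and Robber on a connected graph: the cop player places $k\ge 1$ cops on vertices (not necessarily distinct), then the robber chooses a vertex; then, starting with the cops, the players alternate moves, where in the cops' move each cop either stays or moves to an adjacent vertex, and in the robber's move the robber either stays or moves to an adjacent vertex. The cops win if at some point a cop and the robber occupy the same vertex; both players have complete information. The cop number of a connected graph is the least $k$ such that $k$ cops have a winning strategy; for a disconnected graph it is the maximum cop number of its connected components. -}

module Defs where

open import Data.Nat using (ℕ; suc; _≤_)
open import Data.Fin using (Fin; toℕ)
open import Data.Bool using (Bool; true; false)
open import Data.Product using (Σ; ∃; _×_; _,_)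
open import Data.Sum using (_⊎_)
open import Relation.Binary.PropositionalEquality using (_≡_)
open import Relation.Binary.Construct.Closure.ReflexiveTransitive using (Star)
open import Function.Definitions using (Injective)

record Graph : Set where
  field
    n      : ℕ
    adj    : Fin n → Fin n → Bool
    symm   : ∀ u v → adj u v ≡ adj v u
    irrefl : ∀ u → adj u u ≡ false

module _ (G : Graph) where
  open Graph G

  Adj : Fin n → Fin n → Set
  Adj u v = adj u v ≡ true

  PathAdj : ∀ {ℓ} → Fin ℓ → Fin ℓ → Set
  PathAdj i j = suc (toℕ i) ≡ toℕ j ⊎ suc (toℕ j) ≡ toℕ i

  HasInducedPath : ℕ → Set
  HasInducedPath ℓ =
    Σ (Fin ℓ → Fin n) λ f →
      Injective _≡_ _≡_ f ×
      (∀ i j → (Adj (f i) (f j) → PathAdj i j) × (PathAdj i j → Adj (f i) (f j)))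

  Reach : Fin n → Fin n → Set
  Reach = Star Adj

  Step : Fin n → Fin n → Set
  Step u v = u ≡ v ⊎ Adj u v

  Cops : ℕ → Set
  Cops k = Fin k → Fin n

  CopMove : ∀ {k} → Cops k → Cops k → Set
  CopMove C C' = ∀ i → Step (C i) (C' i)

  Caught : ∀ {k} → Cops k → Fin n → Set
  Caught C r = ∃ λ i → C i ≡ r

  -- CopWin C r : it is the cops' turn, cops at C, robber at r, and the cops
  -- can force capture in finitely many moves (least fixed point = attractor).
  data CopWin {k : ℕ} : Cops k → Fin n → Set where
    caught : ∀ {C r} → Caught C r → CopWin C r
    move   : ∀ {C r} (C' : Cops k) → CopMove C C' →
             (Caught C' r ⊎ (∀ r' → Step r r' → CopWin C' r')) →
             CopWin C r

  CopsWinComponent : ℕ → Fin n → Set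
  CopsWinComponent k v =
    Σ (Cops k) λ C → (∀ i → Reach v (C i)) × (∀ r → Reach v r → CopWin C r)

  -- cop number ≤ m: every connected component has cop number ≤ m,
  -- i.e. some k with 1 ≤ k ≤ m cops win on it.
  CopNumber≤ : ℕ → Set
  CopNumber≤ m = ∀ v → ∃ λ k → 1 ≤ k × k ≤ m × CopsWinComponent k v

-- The cops maintain an induced path x₀ x₁ … x_t with a cop on each vertex (spare cops on
-- x_t), such that the robber lies outside the closed neighbourhood of the path and is
-- reached from x₀ by a walk that, after leaving x₀, avoids x₀ and the closed
-- neighbourhood of x₁ … x_t. Let y be the last neighbour of x₀ on that walk. Then
-- y x₀ … x_t is again an induced path, the rest of the walk from y avoids the closed
-- neighbourhood of x₀ … x_t, and every cop can move one place towards y to occupy the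
-- longer path. If the robber now steps into its closed neighbourhood he is caught on the
-- next move; otherwise the invariant holds again. With ℓ − 2 cops the path never needs
-- more than ℓ − 2 vertices: beyond that, y and the vertex after y on the walk would
-- extend it to an induced P_ℓ.
module Submission where

open import Defs
open import Data.Nat using (ℕ; zero; suc; _+_; _≤_; _∸_; z≤n; s≤s)
open import Data.Nat.Properties using (+-suc; +-comm; m≤n+m; ≤-refl; suc-injective)
open import Data.Fin using (Fin; toℕ) renaming (zero to fzero; suc to fsuc)
import Data.Fin as Fin
open import Data.Bool using (true)
import Data.Bool as Bool
open import Data.List using (List; []; _∷_; length; lookup)
open import Data.List.Relation.Unary.All using (All; []; _∷_)
import Data.List.Relation.Unary.All as All
open import Data.List.Relation.Unary.Any using (Any; here; there; any?)
open import Data.List.Relation.Unary.All.Properties using (¬Any⇒All¬)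
open import Data.List.Membership.Propositional.Properties using (∈-lookup)
open import Data.Vec.Functional using (updateAt)
open import Data.Vec.Functional.Properties using (updateAt-updates; updateAt-minimal)
open import Data.Product using (∃; _×_; _,_; proj₁; proj₂)
open import Data.Sum using (_⊎_; inj₁; inj₂; [_,_]; reduce)
open import Data.Empty using (⊥-elim)
open import Function using (const)
open import Relation.Nullary using (¬_; Dec; yes; no)
open import Relation.Nullary.Decidable using (_⊎-dec_)
open import Relation.Binary.PropositionalEquality using (_≡_; _≢_; refl; sym; trans; cong; subst)
open import Relation.Binary.Construct.Closure.ReflexiveTransitive using (Star; ε; _◅_; _◅◅_)
import Relation.Binary.Construct.Closure.ReflexiveTransitive as Star

module _ (G : Graph) where
  open Graph G

  V : Set
  V = Fin n

  pathAdj-sym : ∀ {ℓ} {i j : Fin ℓ} → PathAdj G i j → PathAdj G j i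
  pathAdj-sym (inj₁ e) = inj₂ e
  pathAdj-sym (inj₂ e) = inj₁ e

  pathAdj-suc : ∀ {ℓ} {i j : Fin ℓ} → PathAdj G i j → PathAdj G (fsuc i) (fsuc j)
  pathAdj-suc (inj₁ e) = inj₁ (cong suc e)
  pathAdj-suc (inj₂ e) = inj₂ (cong suc e)

  pathAdj-pred : ∀ {ℓ} {i j : Fin ℓ} → PathAdj G (fsuc i) (fsuc j) → PathAdj G i j
  pathAdj-pred (inj₁ e) = inj₁ (suc-injective e)
  pathAdj-pred (inj₂ e) = inj₂ (suc-injective e)

  adj-sym : ∀ {u v} → Adj G u v → Adj G v u
  adj-sym {u} {v} a = trans (symm v u) a

  adj-irrefl : ∀ {u v} → Adj G u v → u ≢ v
  adj-irrefl {u} a refl with trans (sym (irrefl u)) a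
  ... | ()

  adj? : ∀ u v → Dec (Adj G u v)
  adj? u v = adj u v Bool.≟ true

  step? : ∀ u v → Dec (Step G u v)
  step? u v = (u Fin.≟ v) ⊎-dec adj? u v

  Dominated : List V → V → Set
  Dominated L u = Any (λ z → Step G z u) L

  Undominated : List V → V → Set
  Undominated L u = All (λ z → ¬ Step G z u) L

  dominated? : ∀ L u → Dec (Dominated L u)
  dominated? L u = any? (λ z → step? z u) L

  undominated : ∀ {L u} → ¬ Dominated L u → Undominated L u
  undominated {L} = ¬Any⇒All¬ L

  data InducedPath : List V → Set where
    single : ∀ x → InducedPath (x ∷ [])
    extend : ∀ {y ys u} → InducedPath (y ∷ ys) → Adj G y u → Undominated ys u →
             InducedPath (u ∷ y ∷ ys)

  head-adj : ∀ {x xs} → InducedPath (x ∷ xs) → (j : Fin (length (x ∷ xs))) →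
             (Adj G x (lookup (x ∷ xs) j) → PathAdj G fzero j) ×
             (PathAdj G fzero j → Adj G x (lookup (x ∷ xs) j))
  head-adj _ fzero = (λ a → ⊥-elim (adj-irrefl a refl)) , λ { (inj₁ ()) ; (inj₂ ()) }
  head-adj (single _) (fsuc ())
  head-adj (extend _ a _) (fsuc fzero) = (λ _ → inj₁ refl) , (λ _ → adj-sym a)
  head-adj (extend _ _ u) (fsuc (fsuc j)) =
    (λ b → ⊥-elim (All.lookup u (∈-lookup j) (inj₂ (adj-sym b)))) , λ { (inj₁ ()) ; (inj₂ ()) }

  inducedPath-adj : ∀ {L} → InducedPath L → (i j : Fin (length L)) →
                    (Adj G (lookup L i) (lookup L j) → PathAdj G i j) ×
                    (PathAdj G i j → Adj G (lookup L i) (lookup L j))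
  inducedPath-adj {_ ∷ _} p fzero j = head-adj p j
  inducedPath-adj p@(extend _ _ _) (fsuc i) fzero =
    (λ b → pathAdj-sym (proj₁ (head-adj p (fsuc i)) (adj-sym b))) ,
    (λ q → adj-sym (proj₂ (head-adj p (fsuc i)) (pathAdj-sym q)))
  inducedPath-adj (extend p _ _) (fsuc i) (fsuc j) =
    (λ b → pathAdj-suc (proj₁ (inducedPath-adj p i j) b)) ,
    (λ q → proj₂ (inducedPath-adj p i j) (pathAdj-pred q))

  head-unique : ∀ {x xs} → InducedPath (x ∷ xs) → (j : Fin (length (x ∷ xs))) →
                x ≡ lookup (x ∷ xs) j → fzero ≡ j
  head-unique _ fzero _ = refl
  head-unique (single _) (fsuc ())
  head-unique (extend _ a _) (fsuc fzero) e = ⊥-elim (adj-irrefl a (sym e))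
  head-unique (extend _ _ u) (fsuc (fsuc j)) e = ⊥-elim (All.lookup u (∈-lookup j) (inj₁ (sym e)))

  inducedPath-injective : ∀ {L} → InducedPath L → (i j : Fin (length L)) →
                          lookup L i ≡ lookup L j → i ≡ j
  inducedPath-injective {_ ∷ _} p fzero j e = head-unique p j e
  inducedPath-injective p@(extend _ _ _) (fsuc i) fzero e = sym (head-unique p (fsuc i) (sym e))
  inducedPath-injective (extend p _ _) (fsuc i) (fsuc j) e = cong fsuc (inducedPath-injective p i j e)

  inducedPath⇒HasInducedPath : ∀ {L} → InducedPath L → HasInducedPath G (length L)
  inducedPath⇒HasInducedPath {L} p =
    lookup L , (λ {i} {j} → inducedPath-injective p i j) , inducedPath-adj p

  -- Position i of the path x ∷ xs, clamped to its last vertex.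
  onPath : V → List V → ℕ → V
  onPath x []       _       = x
  onPath x (_ ∷ _)  zero    = x
  onPath x (w ∷ ws) (suc i) = onPath w ws i

  onPath-zero : ∀ x xs → onPath x xs 0 ≡ x
  onPath-zero x []      = refl
  onPath-zero x (_ ∷ _) = refl

  onPath-step : ∀ {x xs} → InducedPath (x ∷ xs) → ∀ i → Step G (onPath x xs (suc i)) (onPath x xs i)
  onPath-step (single _) _ = inj₁ refl
  onPath-step (extend {y} {ys} _ a _) zero rewrite onPath-zero y ys = inj₂ a
  onPath-step (extend p _ _) (suc i) = onPath-step p i

  onPath-covers : ∀ {P : V → Set} {k} x xs → length (x ∷ xs) ≤ k → Any P (x ∷ xs) →
                  ∃ λ (c : Fin k) → P (onPath x xs (toℕ c))
  onPath-covers {P} x xs (s≤s _) (here px) = fzero , subst P (sym (onPath-zero x xs)) px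
  onPath-covers x (w ∷ ws) (s≤s le) (there pw) with onPath-covers w ws le pw
  ... | c , pc = fsuc c , pc

  -- Walks whose vertices, except the first, satisfy P.
  WalkIn : (V → Set) → V → V → Set
  WalkIn P = Star (λ a b → Adj G a b × P b)

  WalkIn-snoc : ∀ {P : V → Set} {a b c} → WalkIn P a b → Step G b c → P c → WalkIn P a c
  WalkIn-snoc w (inj₁ refl) _  = w
  WalkIn-snoc w (inj₂ bc)   pc = w ◅◅ (bc , pc) ◅ ε

  fromLastVisit : ∀ v {a r} → Reach G a r → WalkIn (v ≢_) v r ⊎ WalkIn (v ≢_) a r
  fromLastVisit v ε = inj₂ ε
  fromLastVisit v (_◅_ {j = b} ab w) with fromLastVisit v w
  ... | inj₁ fromV = inj₁ fromV
  ... | inj₂ fromB with v Fin.≟ b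
  ...   | yes refl = inj₁ fromB
  ...   | no v≢b   = inj₂ ((ab , v≢b) ◅ fromB)

  Beyond : V → List V → V → Set
  Beyond x xs u = x ≢ u × Undominated xs u

  undominated⇒beyond : ∀ {y ys u} → Undominated (y ∷ ys) u → Beyond y ys u
  undominated⇒beyond (¬yu ∷ ys) = (λ e → ¬yu (inj₁ e)) , ys

  adj⇒beyond : ∀ {x y xs u} → Adj G x y → Undominated (x ∷ xs) u → Beyond y (x ∷ xs) u
  adj⇒beyond xy nu@(¬xu ∷ _) = (λ { refl → ¬xu (inj₂ xy) }) , nu

  LastNeighbour : V → List V → V → Set
  LastNeighbour x xs r = ∃ λ y → Adj G x y × Undominated xs y × WalkIn (Undominated (x ∷ xs)) y r

  splitAtLastNeighbour : ∀ {x xs b r} → Undominated (x ∷ xs) r → Beyond x xs b →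
                         WalkIn (Beyond x xs) b r →
                         LastNeighbour x xs r ⊎ (Undominated (x ∷ xs) b × WalkIn (Undominated (x ∷ xs)) b r)
  splitAtLastNeighbour nr _ ε = inj₂ (nr , ε)
  splitAtLastNeighbour {x} {b = b} nr (x≢b , nb) ((bc , beyond-c) ◅ w)
    with splitAtLastNeighbour nr beyond-c w
  ... | inj₁ found = inj₁ found
  ... | inj₂ (nc , wc) with adj? x b
  ...   | yes xb  = inj₁ (b , xb , nb , (bc , nc) ◅ wc)
  ...   | no ¬xb  = inj₂ ([ x≢b , ¬xb ] ∷ nb , (bc , nc) ◅ wc)

  lastNeighbour : ∀ {x xs r} → Undominated (x ∷ xs) r → WalkIn (Beyond x xs) x r → LastNeighbour x xs r
  lastNeighbour (¬xr ∷ _) ε = ⊥-elim (¬xr (inj₁ refl))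
  lastNeighbour nr ((xb , beyond-b) ◅ w) with splitAtLastNeighbour nr beyond-b w
  ... | inj₁ found              = found
  ... | inj₂ ((¬xb ∷ _) , _)     = ⊥-elim (¬xb (inj₂ xb))

  extendEscape : ∀ {x xs y r r′} → Adj G x y → WalkIn (Undominated (x ∷ xs)) y r → Step G r r′ →
                 Undominated (y ∷ x ∷ xs) r′ → WalkIn (Beyond y (x ∷ xs)) y r′
  extendEscape xy walk s nr′ =
    WalkIn-snoc (Star.map (λ (ab , nb) → ab , adj⇒beyond xy nb) walk) s (undominated⇒beyond nr′)

  captureNext : ∀ {k} (C : Cops G k) c {r} → Step G (C c) r → CopWin G C r
  captureNext C c (inj₁ e) = caught (c , e)
  captureNext C c {r} (inj₂ a) = move (updateAt C c (const r)) moves (inj₁ (c , updateAt-updates c C))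
    where
      moves : CopMove G C (updateAt C c (const r))
      moves i with i Fin.≟ c
      ... | yes refl rewrite updateAt-updates i {const r} C = inj₂ a
      ... | no i≢c   = inj₁ (sym (updateAt-minimal i c C i≢c))

  module _ {k : ℕ} (noPath : ¬ HasInducedPath G (suc (suc k))) where

    pathCops : V → List V → Cops G k
    pathCops x xs c = onPath x xs (toℕ c)

    advance : ∀ {x xs y} → InducedPath (x ∷ xs) → Adj G x y →
              CopMove G (pathCops x xs) (pathCops y (x ∷ xs))
    advance {x} {xs} _ xy fzero rewrite onPath-zero x xs = inj₂ xy
    advance p _ (fsuc c) = onPath-step p (toℕ c)

    pathCopsWin : ∀ m {x xs r} → m + length (x ∷ xs) ≡ k → InducedPath (x ∷ xs) →
                  Undominated (x ∷ xs) r → WalkIn (Beyond x xs) x r → CopWin G (pathCops x xs) r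
    pathCopsWin m len p nr escape with lastNeighbour nr escape
    pathCopsWin zero _ _ (¬xr ∷ _) _ | y , xy , _ , ε = ⊥-elim (¬xr (inj₂ xy))
    pathCopsWin zero len p _ _ | y , xy , ny , ((yu , nu) ◅ _) =
      ⊥-elim (noPath (subst (HasInducedPath G) (cong (λ t → suc (suc t)) len)
                            (inducedPath⇒HasInducedPath (extend (extend p xy ny) yu nu))))
    pathCopsWin (suc m) {x} {xs} {r} len p _ _ | y , xy , ny , walk =
      move (pathCops y (x ∷ xs)) (advance p xy) (inj₂ respond)
      where
        len′ : m + length (y ∷ x ∷ xs) ≡ k
        len′ = trans (+-suc m (length (x ∷ xs))) len

        fits : length (y ∷ x ∷ xs) ≤ k
        fits = subst (_ ≤_) len′ (m≤n+m _ m)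

        respond : ∀ r′ → Step G r r′ → CopWin G (pathCops y (x ∷ xs)) r′
        respond r′ s with dominated? (y ∷ x ∷ xs) r′
        ... | yes d = let (c , sc) = onPath-covers y (x ∷ xs) fits d
                      in captureNext (pathCops y (x ∷ xs)) c sc
        ... | no ¬d = let nr′ = undominated ¬d
                      in pathCopsWin m len′ (extend p xy ny) nr′ (extendEscape xy walk s nr′)

  copsWinFrom : ∀ {j v r} → ¬ HasInducedPath G (3 + j) → Reach G v r → CopWin G {suc j} (λ _ → v) r
  copsWinFrom {j} {v} {r} noPath reach with step? v r
  ... | yes s = captureNext (λ _ → v) fzero s
  ... | no ¬s = pathCopsWin noPath j (+-comm j 1) (single v) (¬s ∷ [])
                  (Star.map (λ (ab , v≢b) → ab , v≢b , []) (reduce (fromLastVisit v reach)))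

proposition2 : (ℓ : ℕ) → 3 ≤ ℓ → (G : Graph) → ¬ HasInducedPath G ℓ → CopNumber≤ G (ℓ ∸ 2)
proposition2 (suc (suc (suc j))) (s≤s (s≤s (s≤s _))) G noPath v =
  suc j , s≤s z≤n , ≤-refl , (λ _ → v) , (λ _ → ε) , λ r → copsWinFrom G noPath
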